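{- Let $D$ be a balanced bipartite digraph with colour classes $X$ and $Y$ of cardinalities $a$, where $a\geq 2$, such that $d_D(u)+d_D(v)\geq 3a+1$ for every pair of distinct vertices $u,v$ with $uv\notin A(D)$ and $vu\notin A(D)$. Then $D$ contains a complete matching from $X$ to $Y$ or a complete matching from $Y$ to $X$.
   Context: A digraph has a finite vertex set and a set of arcs (ordered pairs of distinct vertices), with no loops or multiple arcs. $d_D(v)=d_D^+(v)+d_D^-(v)$ is the sum of outdegree and indegree. Bipartite with colour classes $X,Y$ means $V(D)=X\sqcup Y$ and all arcs go between $X$ and $Y$; balanced means $|X|=|Y|$. A matching from $X$ to $Y$ is a set of pairwise vertex-disjoint arcs each with origin in $X$ and terminus in $Y$; it is complete if it has $|X|$ arcs. -}

module Defs where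

open import Data.Nat using (ℕ; _+_)
open import Data.Bool using (Bool; true; false)
open import Data.Fin using (Fin)
open import Data.Sum using (_⊎_; inj₁; inj₂)
open import Data.Product using (_×_; Σ)
open import Data.Vec.Functional using (foldr)
open import Relation.Binary.PropositionalEquality using (_≡_; _≢_)
open import Function.Definitions using (Injective)
open import Relation.Nullary using (¬_)
open import Data.Empty using (⊥)

-- Vertex set is X ⊎ Y; arcs go only between X and Y.
-- xy x y = true  iff  (x , y) is an arc from x ∈ X to y ∈ Y;
-- yx y x = true  iff  (y , x) is an arc from y ∈ Y to x ∈ X.
record BipDigraph (a : ℕ) : Set where
  field
    xy : Fin a → Fin a → Bool
    yx : Fin a → Fin a → Bool
open BipDigraph public

Vertex : ℕ → Set
Vertex a = Fin a ⊎ Fin a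

Arc : ∀ {a} → BipDigraph a → Vertex a → Vertex a → Set
Arc D (inj₁ x) (inj₂ y) = xy D x y ≡ true
Arc D (inj₂ y) (inj₁ x) = yx D y x ≡ true
Arc D (inj₁ _) (inj₁ _) = ⊥
Arc D (inj₂ _) (inj₂ _) = ⊥

countB : ∀ {n} → (Fin n → Bool) → ℕ
countB f = foldr (λ b k → (if b then 1 else 0) + k) 0 f
  where
  if_then_else_ : Bool → ℕ → ℕ → ℕ
  if true then m else _ = m
  if false then _ else n = n

outdeg : ∀ {a} → BipDigraph a → Vertex a → ℕ
outdeg D (inj₁ x) = countB (λ y → xy D x y)
outdeg D (inj₂ y) = countB (λ x → yx D y x)

indeg : ∀ {a} → BipDigraph a → Vertex a → ℕ
indeg D (inj₁ x) = countB (λ y → yx D y x)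
indeg D (inj₂ y) = countB (λ x → xy D x y)

deg : ∀ {a} → BipDigraph a → Vertex a → ℕ
deg D v = outdeg D v + indeg D v

-- complete matching from X to Y: |X| pairwise vertex-disjoint arcs x → f x
CompleteMatchingXY : ∀ {a} → BipDigraph a → Set
CompleteMatchingXY {a} D =
  Σ (Fin a → Fin a) (λ f → Injective _≡_ _≡_ f × (∀ x → xy D x (f x) ≡ true))

CompleteMatchingYX : ∀ {a} → BipDigraph a → Set
CompleteMatchingYX {a} D =
  Σ (Fin a → Fin a) (λ g → Injective _≡_ _≡_ g × (∀ y → yx D y (g y) ≡ true))

module Submission where

-- Proof strategy (the conclusion always holds with a matching X → Y).
-- Vertices of one colour class are pairwise nonadjacent and have at most a
-- arcs from the other class, so any two distinct x, x' ∈ X satisfy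
-- d⁺(x) + d⁺(x') > a, and dually for in-degrees in Y.  Hence all x except
-- one xₘ of minimum out-degree, and all y except one yₘ of minimum
-- in-degree, have more than a/2 arcs.  Matchings are sought among
-- permutations π of Fin a.  The general augmentation lemma: if every
-- uncovered x (x → π x not an arc) has d⁺(x) + d⁻(π x) > a, pigeonhole gives
-- x' with x → π x' and x' → π x; swapping the two partners covers more
-- vertices and keeps the condition, so iterating yields a perfect matching.
-- A starting permutation covering xₘ and yₘ satisfies the condition by the
-- degree bounds.

open import Defs
open import Data.Nat using (ℕ; zero; suc; _≤_; _<_; _+_; _*_; z≤n; s≤s; z<s)
open import Data.Nat.Properties
open import Data.Nat.Solver using (module +-*-Solver)
open import Data.Bool using (Bool; true; false)
import Data.Bool.Properties as Bool
open import Data.Fin using (Fin; zero; suc)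
open import Data.Fin.Properties using (all?; ¬∀⟶∃¬) renaming (_≟_ to _≟ᶠ_)
open import Data.Fin.Permutation as Perm using (Permutation; _⟨$⟩ʳ_; _⟨$⟩ˡ_; _∘ₚ_)
import Data.Fin.Permutation.Components as PC
open import Data.List using (allFin)
open import Data.List.Extrema.Nat using (argmin; f[argmin]≤f[xs])
import Data.List.Relation.Unary.All as All
open import Data.List.Membership.Propositional.Properties using (∈-allFin)
import Algebra.Properties.CommutativeMonoid.Sum as MonoidSum
open import Data.Sum using (_⊎_; inj₁; inj₂)
open import Data.Sum.Properties using (inj₁-injective; inj₂-injective)
open import Data.Product using (Σ; ∃; _×_; _,_; proj₁; proj₂)
open import Data.Empty using (⊥-elim)
open import Function using (_∘_)
open import Function.Definitions using (Injective)
open import Relation.Binary.PropositionalEquality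
open import Relation.Nullary using (¬_; Dec; yes; no; contradiction)
open import Relation.Nullary.Decidable using (dec-true; dec-false)

b2n : Bool → ℕ
b2n true = 1
b2n false = 0

countB-suc : ∀ {n} (f : Fin (suc n) → Bool) →
             countB f ≡ b2n (f zero) + countB (f ∘ suc)
countB-suc f with f zero
... | true = refl
... | false = refl

countB≤ : ∀ {n} (f : Fin n → Bool) → countB f ≤ n
countB≤ {zero} f = z≤n
countB≤ {suc n} f rewrite countB-suc f with f zero
... | true = s≤s (countB≤ (f ∘ suc))
... | false = m≤n⇒m≤1+n (countB≤ (f ∘ suc))

-- countB agrees with the monoid sum of indicators, which is invariant
-- under permuting the arguments.
module ℕ-Sum = MonoidSum +-0-commutativeMonoid

countB-sum : ∀ {n} (f : Fin n → Bool) → countB f ≡ ℕ-Sum.sum (b2n ∘ f)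
countB-sum {zero} f = refl
countB-sum {suc n} f = trans (countB-suc f) (cong (b2n (f zero) +_) (countB-sum (f ∘ suc)))

countB-permute : ∀ {n} (f : Fin n → Bool) (π : Permutation n n) →
                 countB (f ∘ (π ⟨$⟩ʳ_)) ≡ countB f
countB-permute f π = begin
  countB (f ∘ (π ⟨$⟩ʳ_))        ≡⟨ countB-sum (f ∘ (π ⟨$⟩ʳ_)) ⟩
  ℕ-Sum.sum (b2n ∘ f ∘ (π ⟨$⟩ʳ_)) ≡⟨ ℕ-Sum.sum-permute (b2n ∘ f) π ⟨
  ℕ-Sum.sum (b2n ∘ f)           ≡⟨ countB-sum f ⟨
  countB f                      ∎
  where open ≡-Reasoning

countB-overlap : ∀ {n} (f g : Fin n → Bool) → n < countB f + countB g →
                 ∃ λ i → f i ≡ true × g i ≡ true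
countB-overlap {zero} f g ()
countB-overlap {suc n} f g n<
  rewrite countB-suc f | countB-suc g with f zero in fz | g zero in gz
... | true | true = zero , fz , gz
... | true | false =
  let (i , fi , gi) = countB-overlap (f ∘ suc) (g ∘ suc) (≤-pred n<) in suc i , fi , gi
... | false | true =
  let (i , fi , gi) = countB-overlap (f ∘ suc) (g ∘ suc) (≤-pred (subst (suc n <_) (+-suc _ _) n<))
  in suc i , fi , gi
... | false | false =
  let (i , fi , gi) = countB-overlap (f ∘ suc) (g ∘ suc) (≤-trans (n≤1+n _) n<) in suc i , fi , gi

countB-witness : ∀ {n} (f : Fin n → Bool) → 0 < countB f → ∃ λ i → f i ≡ true
countB-witness {zero} f ()
countB-witness {suc n} f 0< rewrite countB-suc f with f zero in fz
... | true = zero , fz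
... | false with countB-witness (f ∘ suc) 0<
...   | i , fi = suc i , fi

countB-mono : ∀ {n} (f g : Fin n → Bool) → (∀ i → f i ≡ true → g i ≡ true) →
              countB f ≤ countB g
countB-mono {zero} f g f⊆g = z≤n
countB-mono {suc n} f g f⊆g rewrite countB-suc f | countB-suc g with f zero in fz
... | true rewrite f⊆g zero fz = s≤s (countB-mono (f ∘ suc) (g ∘ suc) (f⊆g ∘ suc))
... | false = ≤-trans (countB-mono (f ∘ suc) (g ∘ suc) (f⊆g ∘ suc)) (m≤n+m _ (b2n (g zero)))

countB-grows : ∀ {n} (f g : Fin n → Bool) → (∀ i → f i ≡ true → g i ≡ true) →
               ∀ j → f j ≢ true → g j ≡ true → countB f < countB g
countB-grows {suc n} f g f⊆g zero fj gj
  rewrite countB-suc f | countB-suc g | gj | Bool.¬-not fj =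
  s≤s (countB-mono (f ∘ suc) (g ∘ suc) (f⊆g ∘ suc))
countB-grows {suc n} f g f⊆g (suc j) fj gj
  rewrite countB-suc f | countB-suc g with f zero in fz
... | true rewrite f⊆g zero fz = s≤s (countB-grows (f ∘ suc) (g ∘ suc) (f⊆g ∘ suc) j fj gj)
... | false = <-≤-trans (countB-grows (f ∘ suc) (g ∘ suc) (f⊆g ∘ suc) j fj gj)
                        (m≤n+m _ (b2n (g zero)))

transpose-matchˡ : ∀ {n} (i j : Fin n) → PC.transpose i j i ≡ j
transpose-matchˡ i j rewrite dec-true (i ≟ᶠ i) refl = refl

transpose-matchʳ : ∀ {n} (i j : Fin n) → PC.transpose i j j ≡ i
transpose-matchʳ i j with i ≟ᶠ j
... | yes refl rewrite dec-true (i ≟ᶠ i) refl = refl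
... | no i≢j rewrite dec-false (j ≟ᶠ i) (i≢j ∘ sym) | dec-true (j ≟ᶠ j) refl = refl

transpose-other : ∀ {n} (i j k : Fin n) → k ≢ i → k ≢ j → PC.transpose i j k ≡ k
transpose-other i j k k≢i k≢j rewrite dec-false (k ≟ᶠ i) k≢i | dec-false (k ≟ᶠ j) k≢j = refl

transpose-cases : ∀ {n} (i j k : Fin n) → k ≡ i ⊎ k ≡ j ⊎ PC.transpose i j k ≡ k
transpose-cases i j k = cases (k ≟ᶠ i) (k ≟ᶠ j)
  where
  cases : Dec (k ≡ i) → Dec (k ≡ j) → k ≡ i ⊎ k ≡ j ⊎ PC.transpose i j k ≡ k
  cases (yes k≡i) _ = inj₁ k≡i
  cases (no _) (yes k≡j) = inj₂ (inj₁ k≡j)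
  cases (no k≢i) (no k≢j) = inj₂ (inj₂ (transpose-other i j k k≢i k≢j))

permutation-injective : ∀ {n} (π : Permutation n n) → Injective _≡_ _≡_ (π ⟨$⟩ʳ_)
permutation-injective π {x} {y} πx≡πy = begin
  x                   ≡⟨ Perm.inverseˡ π ⟨
  π ⟨$⟩ˡ (π ⟨$⟩ʳ x)   ≡⟨ cong (π ⟨$⟩ˡ_) πx≡πy ⟩
  π ⟨$⟩ˡ (π ⟨$⟩ʳ y)   ≡⟨ Perm.inverseˡ π ⟩
  y                   ∎
  where open ≡-Reasoning

-- Any two prescribed values at two distinct points extend to a permutation:
-- first move x₀ to y₀, then move the image of x₁ to y₁.
permutation-through : ∀ {n} {x₀ x₁ y₀ y₁ : Fin n} → x₀ ≢ x₁ → y₀ ≢ y₁ →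
                      ∃ λ (π : Permutation n n) → π ⟨$⟩ʳ x₀ ≡ y₀ × π ⟨$⟩ʳ x₁ ≡ y₁
permutation-through {x₀ = x₀} {x₁} {y₀} {y₁} x₀≢x₁ y₀≢y₁ =
  Perm.transpose x₀ y₀ ∘ₚ Perm.transpose z y₁ , sends-x₀ , transpose-matchˡ z y₁
  where
  z = PC.transpose x₀ y₀ x₁
  y₀≢z : y₀ ≢ z
  y₀≢z y₀≡z = x₀≢x₁ (permutation-injective (Perm.transpose x₀ y₀)
                      (trans (transpose-matchˡ x₀ y₀) y₀≡z))
  sends-x₀ : PC.transpose z y₁ (PC.transpose x₀ y₀ x₀) ≡ y₀
  sends-x₀ rewrite transpose-matchˡ x₀ y₀ = transpose-other z y₁ y₀ y₀≢z y₀≢y₁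

module Augmentation {n} (R : Fin n → Fin n → Bool) where

  outR : Fin n → ℕ
  outR x = countB (R x)

  inR : Fin n → ℕ
  inR y = countB (λ x → R x y)

  PerfectMatching : Set
  PerfectMatching = Σ (Fin n → Fin n) λ f → Injective _≡_ _≡_ f × (∀ x → R x (f x) ≡ true)

  covered : Permutation n n → Fin n → Bool
  covered π x = R x (π ⟨$⟩ʳ x)

  OreCondition : Permutation n n → Set
  OreCondition π = ∀ x → covered π x ≢ true → n < outR x + inR (π ⟨$⟩ʳ x)

  -- Swapping the partners of an uncovered x₀ and a suitable x covers both
  -- and leaves all other partners unchanged.
  augment-step : ∀ π → OreCondition π → ∀ x₀ → covered π x₀ ≢ true →
                 ∃ λ π′ → OreCondition π′ × countB (covered π) < countB (covered π′)
  augment-step π ore x₀ x₀-uncovered =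
    π′ , ore′ , countB-grows (covered π) (covered π′) covered-mono x₀ x₀-uncovered x₀-covered
    where
    y₀ = π ⟨$⟩ʳ x₀
    enough : n < countB (λ i → R x₀ (π ⟨$⟩ʳ i)) + inR y₀
    enough = subst (λ k → n < k + inR y₀) (sym (countB-permute (R x₀) π)) (ore x₀ x₀-uncovered)
    pivot = countB-overlap (λ i → R x₀ (π ⟨$⟩ʳ i)) (λ i → R i y₀) enough
    x = proj₁ pivot
    π′ = Perm.transpose x₀ x ∘ₚ π
    x₀-covered : covered π′ x₀ ≡ true
    x₀-covered rewrite transpose-matchˡ x₀ x = proj₁ (proj₂ pivot)
    x-covered : covered π′ x ≡ true
    x-covered rewrite transpose-matchʳ x₀ x = proj₂ (proj₂ pivot)
    covered-or-unchanged : ∀ i → covered π′ i ≡ true ⊎ π′ ⟨$⟩ʳ i ≡ π ⟨$⟩ʳ i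
    covered-or-unchanged i with transpose-cases x₀ x i
    ... | inj₁ refl = inj₁ x₀-covered
    ... | inj₂ (inj₁ refl) = inj₁ x-covered
    ... | inj₂ (inj₂ fixed) = inj₂ (cong (π ⟨$⟩ʳ_) fixed)
    covered-mono : ∀ i → covered π i ≡ true → covered π′ i ≡ true
    covered-mono i i-covered with covered-or-unchanged i
    ... | inj₁ i-covered′ = i-covered′
    ... | inj₂ same rewrite same = i-covered
    ore′ : OreCondition π′
    ore′ i i-uncovered with covered-or-unchanged i
    ... | inj₁ i-covered′ = contradiction i-covered′ i-uncovered
    ... | inj₂ same rewrite same = ore i i-uncovered′
      where
      i-uncovered′ : covered π i ≢ true
      i-uncovered′ rewrite sym same = i-uncovered

  -- Iterating the step; k bounds the number of remaining steps.
  augment : ∀ k π → OreCondition π → n ≤ k + countB (covered π) → PerfectMatching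
  augment k π ore bound with all? (λ x → covered π x Bool.≟ true)
  ... | yes all-covered = (π ⟨$⟩ʳ_) , permutation-injective π , all-covered
  ... | no not-all with ¬∀⟶∃¬ n _ (λ x → covered π x Bool.≟ true) not-all
  ...   | x₀ , x₀-uncovered with augment-step π ore x₀ x₀-uncovered | k
  ...     | π′ , ore′ , grows | zero =
    ⊥-elim (<-irrefl refl (<-≤-trans (≤-<-trans bound grows) (countB≤ (covered π′))))
  ...     | π′ , ore′ , grows | suc k =
    augment k π′ ore′ (≤-trans bound (≤-trans (≤-reflexive (sym (+-suc k _))) (+-monoʳ-≤ k grows)))

  perfect-matching : ∀ π → OreCondition π → PerfectMatching
  perfect-matching π ore = augment n π ore (m≤m+n n _)

  CoversBoth : Fin n → Fin n → Permutation n n → Set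
  CoversBoth x₀ y₀ π = covered π x₀ ≡ true × ∃ λ x → π ⟨$⟩ʳ x ≡ y₀ × covered π x ≡ true

  -- A vertex x₀ with an out-arc and a vertex y₀ with an in-arc can be
  -- covered simultaneously: use the arc x₀ → y₀ if present, otherwise
  -- arcs x₀ → y₁ and x₁ → y₀, where necessarily x₁ ≠ x₀ and y₁ ≠ y₀.
  covering-both : ∀ x₀ y₀ → (∃ λ y → R x₀ y ≡ true) → (∃ λ x → R x y₀ ≡ true) →
                  ∃ (CoversBoth x₀ y₀)
  covering-both x₀ y₀ (y₁ , x₀→y₁) (x₁ , x₁→y₀) with R x₀ y₀ in arc
  ... | true = Perm.transpose x₀ y₀ , x₀-covered , x₀ , transpose-matchˡ x₀ y₀ , x₀-covered
    where
    x₀-covered : covered (Perm.transpose x₀ y₀) x₀ ≡ true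
    x₀-covered rewrite transpose-matchˡ x₀ y₀ = arc
  ... | false =
    let (π , πx₀≡y₁ , πx₁≡y₀) = permutation-through x₀≢x₁ y₁≢y₀
    in π , subst (λ y → R x₀ y ≡ true) (sym πx₀≡y₁) x₀→y₁ ,
       x₁ , πx₁≡y₀ , subst (λ y → R x₁ y ≡ true) (sym πx₁≡y₀) x₁→y₀
    where
    x₀≢x₁ : x₀ ≢ x₁
    x₀≢x₁ refl = contradiction (trans (sym x₁→y₀) arc) λ ()
    y₁≢y₀ : y₁ ≢ y₀
    y₁≢y₀ refl = contradiction (trans (sym x₀→y₁) arc) λ ()

  -- If all pairs avoiding x₀ and y₀ satisfy the degree bound, then any π
  -- covering both satisfies the Ore condition: no uncovered x is x₀, and
  -- no uncovered x has partner y₀.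
  ore-from-cover : ∀ {x₀ y₀} → (∀ {x y} → x ≢ x₀ → y ≢ y₀ → n < outR x + inR y) →
                   ∀ π → CoversBoth x₀ y₀ π → OreCondition π
  ore-from-cover heavy π (x₀-covered , x₁ , πx₁≡y₀ , x₁-covered) x x-uncovered =
    heavy x≢x₀ πx≢y₀
    where
    x≢x₀ : x ≢ _
    x≢x₀ refl = x-uncovered x₀-covered
    πx≢y₀ : π ⟨$⟩ʳ x ≢ _
    πx≢y₀ πx≡y₀ = x-uncovered (subst (λ i → covered π i ≡ true)
      (permutation-injective π (trans πx₁≡y₀ (sym πx≡y₀))) x₁-covered)

drop-bounded : ∀ a p q r s → 3 * a + 1 ≤ (p + q) + (r + s) → q ≤ a → s ≤ a → a < p + r
drop-bounded a p q r s bound q≤a s≤a = +-cancelʳ-≤ (a + a) (suc a) (p + r) (begin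
  suc a + (a + a)    ≡⟨ solve 1 (λ a → (con 1 :+ a) :+ (a :+ a) := con 3 :* a :+ con 1) refl a ⟩
  3 * a + 1          ≤⟨ bound ⟩
  (p + q) + (r + s)  ≤⟨ +-mono-≤ (+-monoʳ-≤ p q≤a) (+-monoʳ-≤ r s≤a) ⟩
  (p + a) + (r + a)  ≡⟨ solve 3 (λ p r a → (p :+ a) :+ (r :+ a) := (p :+ r) :+ (a :+ a)) refl p r a ⟩
  (p + r) + (a + a)  ∎)
  where
  open ≤-Reasoning
  open +-*-Solver

sum-of-halves : ∀ {a p r} → a < p + p → a < r + r → a < p + r
sum-of-halves {p = p} {r} a<p+p a<r+r with ≤-total p r
... | inj₁ p≤r = <-≤-trans a<p+p (+-monoʳ-≤ p p≤r)
... | inj₂ r≤p = <-≤-trans a<r+r (+-monoˡ-≤ r r≤p)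

positive-summand : ∀ {a m k} → a < m + k → k ≤ a → 0 < m
positive-summand {m = zero} a<k k≤a = contradiction k≤a (<⇒≱ a<k)
positive-summand {m = suc m} _ _ = z<s

minimiser : ∀ {n} (g : Fin (suc n) → ℕ) → ∃ λ i → ∀ j → g i ≤ g j
minimiser g = argmin g zero (allFin _) ,
              λ j → All.lookup (f[argmin]≤f[xs] {f = g} zero (allFin _)) (∈-allFin j)

DegreeCondition : ∀ {a} → BipDigraph a → Set
DegreeCondition {a} D = ∀ (u v : Vertex a) → u ≢ v → ¬ Arc D u v → ¬ Arc D v u →
                        3 * a + 1 ≤ deg D u + deg D v

-- Under the degree condition, when each class has at least two vertices
-- (every vertex has a distinct companion), D has a complete matching X → Y.
module MatchingXY {n} (D : BipDigraph (suc n)) (degree-condition : DegreeCondition D)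
                  (companion : (i : Fin (suc n)) → ∃ λ j → i ≢ j) where

  open Augmentation (xy D)

  -- Vertices of one colour class are nonadjacent, and the arcs entering
  -- (for X) resp. leaving (for Y) a vertex number at most a.
  outR-pair : ∀ {x x′} → x ≢ x′ → suc n < outR x + outR x′
  outR-pair {x} {x′} x≢x′ =
    drop-bounded (suc n) (outR x) (indeg D (inj₁ x)) (outR x′) (indeg D (inj₁ x′))
      (degree-condition (inj₁ x) (inj₁ x′) (x≢x′ ∘ inj₁-injective) (λ ()) (λ ()))
      (countB≤ (λ y → yx D y x)) (countB≤ (λ y → yx D y x′))

  inR-pair : ∀ {y y′} → y ≢ y′ → suc n < inR y + inR y′
  inR-pair {y} {y′} y≢y′ =
    drop-bounded (suc n) (inR y) (outdeg D (inj₂ y)) (inR y′) (outdeg D (inj₂ y′))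
      (subst (3 * suc n + 1 ≤_)
        (cong₂ _+_ (+-comm (outdeg D (inj₂ y)) (inR y)) (+-comm (outdeg D (inj₂ y′)) (inR y′)))
        (degree-condition (inj₂ y) (inj₂ y′) (y≢y′ ∘ inj₂-injective) (λ ()) (λ ())))
      (countB≤ (yx D y)) (countB≤ (yx D y′))

  xₘ yₘ : Fin (suc n)
  xₘ = proj₁ (minimiser outR)
  yₘ = proj₁ (minimiser inR)

  heavy-pair : ∀ {x y} → x ≢ xₘ → y ≢ yₘ → suc n < outR x + inR y
  heavy-pair {x} {y} x≢xₘ y≢yₘ = sum-of-halves {p = outR x} {r = inR y}
    (<-≤-trans (outR-pair x≢xₘ) (+-monoʳ-≤ (outR x) (proj₂ (minimiser outR) x)))
    (<-≤-trans (inR-pair y≢yₘ) (+-monoʳ-≤ (inR y) (proj₂ (minimiser inR) y)))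

  -- Both minima have a neighbour, since their companions have degree ≤ a.
  xₘ-has-arc : ∃ λ y → xy D xₘ y ≡ true
  xₘ-has-arc = let (x′ , xₘ≢x′) = companion xₘ in
    countB-witness (xy D xₘ)
      (positive-summand {m = outR xₘ} (outR-pair xₘ≢x′) (countB≤ (xy D x′)))

  yₘ-has-arc : ∃ λ x → xy D x yₘ ≡ true
  yₘ-has-arc = let (y′ , yₘ≢y′) = companion yₘ in
    countB-witness (λ x → xy D x yₘ)
      (positive-summand {m = inR yₘ} (inR-pair yₘ≢y′) (countB≤ (λ x → xy D x y′)))

  complete-matching : CompleteMatchingXY D
  complete-matching =
    let (π , covers) = covering-both xₘ yₘ xₘ-has-arc yₘ-has-arc
    in perfect-matching π (ore-from-cover heavy-pair π covers)

lemma2p2 : (a : ℕ) → 2 ≤ a → (D : BipDigraph a) →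
    (∀ (u v : Vertex a) → u ≢ v → ¬ Arc D u v → ¬ Arc D v u →
      3 * a + 1 ≤ deg D u + deg D v) →
    CompleteMatchingXY D ⊎ CompleteMatchingYX D
lemma2p2 (suc zero) (s≤s ()) _ _
lemma2p2 (suc (suc b)) _ D degree-condition =
  inj₁ (MatchingXY.complete-matching D degree-condition companion)
  where
  companion : (i : Fin (suc (suc b))) → ∃ λ j → i ≢ j
  companion zero = suc zero , λ ()
  companion (suc i) = zero , λ ()
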